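{- Let $n\in\mathbb{Z}_{>0}$. For any integer partition $\lambda$ with $\lambda_1+\ell(\lambda)-1=n$, there exists a unique Coxeter element $c$ of $\mathfrak{S}_{n+1}$ such that $\boldsymbol{\lambda}(c)=\lambda$.
   Context: Let $s_i=(i,i+1)\in\mathfrak{S}_{n+1}$. A Coxeter element of $\mathfrak{S}_{n+1}$ is a product $s_{\sigma(1)}\cdots s_{\sigma(n)}$ for some permutation $\sigma$ of $\{1,\dots,n\}$. Every Coxeter element can be written uniquely as a cycle $c=(c_1,c_2,\dots,c_m,c_{m+1},\dots,c_{n+1})$ with $1=c_1<c_2<\dots<c_m=n+1>c_{m+1}>\dots>c_{n+1}>1$; set $L_c=\{c_2,\dots,c_{m-1}\}$ and $R_c=\{c_{m+1},\dots,c_{n+1}\}$ (so $(L_c,R_c)$ is a bipartition of $\{2,\dots,n\}$). Write $L_c\cup\{1\}=\{a_1<\dots<a_p\}$ and define the integer partition $\boldsymbol{\lambda}(c)$ by $\boldsymbol{\lambda}(c)_i=\#\{r\in R_c\cup\{n+1\}: a_i<r\}$ for $1\leqslant i\leqslant p$. -}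

module Defs where

open import Data.Nat using (ℕ; zero; suc; _+_; _≥_; _<_)
open import Data.Bool using (Bool; true; false; not; _∧_; _∨_)
open import Data.Fin using (Fin; zero; suc; inject₁; fromℕ; _<?_)
open import Data.Fin.Properties using (_≟_)
open import Data.Fin.Permutation using (Permutation′; _⟨$⟩ʳ_)
open import Data.List using (List; []; _∷_; map; length; iterate; allFin; filterᵇ; takeWhileᵇ; foldr)
open import Data.Bool.ListAction using (any)
open import Data.List.Relation.Unary.All using (All)
open import Data.List.Relation.Unary.Linked using (Linked)
open import Data.Vec using (Vec; lookup; tabulate)
open import Data.Product using (∃-syntax; _×_)
open import Function using (_∘_; id)
open import Relation.Nullary.Decidable using (⌊_⌋)
open import Relation.Binary.PropositionalEquality using (_≡_)

-- Conventions: {1,…,n+1} is represented by Fin (suc n), with the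
-- number k represented by the element of value k-1.  Thus 1 ↦ zero and
-- n+1 ↦ fromℕ n.  Permutations of {1,…,n+1} are given in one-line
-- notation as vectors c with c(x) = lookup c x.

-- the simple transposition s_i = (i,i+1), i ∈ {1,…,n}, as a map on Fin (suc n)
-- (i : Fin n represents the number i+1)
s : ∀ {n} → Fin n → Fin (suc n) → Fin (suc n)
s i j with ⌊ j ≟ inject₁ i ⌋ | ⌊ j ≟ suc i ⌋
... | true  | _     = suc i
... | false | true  = inject₁ i
... | false | false = j

coxProd : ∀ {n} → Permutation′ n → Fin (suc n) → Fin (suc n)
coxProd {n} σ = foldr (λ i f → s (σ ⟨$⟩ʳ i) ∘ f) id (allFin n)

IsCoxeter : ∀ n → Vec (Fin (suc n)) (suc n) → Set
IsCoxeter n c = ∃[ σ ] c ≡ tabulate (coxProd {n} σ)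

_∈ᵇ_ : ∀ {m} → Fin m → List (Fin m) → Bool
x ∈ᵇ xs = any (λ y → ⌊ x ≟ y ⌋) xs

-- Writing c = (c_1, c_2, …, c_{n+1}) with c_1 = 1 (so c_{k+1} = c^k(1)),
-- and c_m = n+1, L_c = {c_2,…,c_{m-1}}: the elements c^k(1), k ≥ 1,
-- occurring before n+1 in the orbit of 1.
Lset : ∀ {n} → Vec (Fin (suc n)) (suc n) → List (Fin (suc n))
Lset {n} c = takeWhileᵇ (λ x → not ⌊ x ≟ fromℕ n ⌋)
                        (iterate (lookup c) (lookup c zero) n)

-- R_c ∪ {n+1} = {2,…,n+1} ∖ L_c
RsetPlus : ∀ {n} → Vec (Fin (suc n)) (suc n) → List (Fin (suc n))
RsetPlus {n} c = filterᵇ (λ x → not ⌊ x ≟ zero ⌋ ∧ not (x ∈ᵇ Lset c)) (allFin (suc n))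

Aset : ∀ {n} → Vec (Fin (suc n)) (suc n) → List (Fin (suc n))
Aset {n} c = filterᵇ (λ x → ⌊ x ≟ zero ⌋ ∨ (x ∈ᵇ Lset c)) (allFin (suc n))

lam : ∀ {n} → Vec (Fin (suc n)) (suc n) → List ℕ
lam c = map (λ a → length (filterᵇ (λ r → ⌊ a <? r ⌋) (RsetPlus c))) (Aset c)

IsPartition : List ℕ → Set
IsPartition λs = All (0 <_) λs × Linked _≥_ λs

-- λ_1 (with λ_1 = 0 for the empty partition)
firstPart : List ℕ → ℕ
firstPart []      = 0
firstPart (x ∷ _) = x

-- Number 1, …, n+1 as 0, …, n, so that s_i swaps i and i+1 (i < n).  The image of x under a product
-- of distinct adjacent transpositions has a closed form (coxMap): x is first moved by whichever of
-- s_{x-1}, s_x acts first, and then keeps moving in that direction while the next letter acts later.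
-- So a Coxeter element is determined by its orientation D k = [s_{k-1} stands left of s_k], 0 < k < n,
-- and every orientation occurs.  The orbit of 0 climbs exactly through the k with D k, hence
-- L_c = {k : D k}; λ(c) is read off the indicator path of L_c ∪ {0} on 0, …, n (each true counts the
-- falses after it).  These paths, which start with true and end with false, are the boundary paths
-- of the partitions λ with λ₁ + ℓ(λ) = n + 1, which gives the bijection c ↦ λ(c).
module Submission where

open import Defs

open import Data.Bool using (Bool; true; false; not; _∧_; _∨_; if_then_else_; T)
open import Data.Bool.Properties using (if-float; ∨-zeroʳ; ∧-identityʳ)
open import Data.Bool.ListAction using (any; or)
open import Data.Unit using (tt)
open import Data.Nat using (ℕ; zero; suc; pred; _∸_; _+_; _≤_; _<_; _≥_; z≤n; s≤s; z<s; _≡ᵇ_; _<ᵇ_; _≟_; _<?_)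
open import Data.Nat.Properties
  using ( <ᵇ⇒<; 1+n≢n; suc-injective; n≤1+n; m≤n+m; m≤n⇒m≤1+n; ≤-refl; ≤-trans; ≤-antisym; <-irrefl; <-trans
        ; <-cmp; <⇒≢; >⇒≢; <⇒≤; <⇒≱; ≤⇒≯; ≮⇒≥; ≤∧≢⇒<; +-identityʳ; +-suc; +-assoc; +-monoˡ-≤; m∸n+n≡m )
open import Data.Fin using (Fin; zero; suc; toℕ; inject₁; fromℕ; fromℕ<; punchIn)
import Data.Fin as Fin
import Data.Fin.Properties as F
open import Data.Fin.Properties using (toℕ-injective; toℕ-inject₁; toℕ-fromℕ; toℕ-fromℕ<; toℕ<n; toℕ≤pred[n])
open import Data.Fin.Permutation using (Permutation′; _⟨$⟩ʳ_; _⟨$⟩ˡ_; inverseˡ; inverseʳ; insert; insert-punchIn)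
import Data.Fin.Permutation as FP
open import Data.List
  using (List; []; _∷_; _++_; _∷ʳ_; length; map; foldr; replicate; iterate; tabulate; allFin; filterᵇ; takeWhileᵇ)
open import Data.List.Properties
  using ( ∷-injectiveˡ; ∷-injectiveʳ; map-cong; map-cong-local; map-∘; map-tabulate; tabulate-cong; foldr-∷ʳ
        ; length-++; length-replicate; ++-identityʳ )
open import Data.List.Membership.Propositional using (_∈_)
open import Data.List.Membership.Propositional.Properties using (∈-map⁺; ∈-allFin)
open import Data.List.Relation.Unary.Any using (here; there)
open import Data.List.Relation.Unary.All using (All; []; _∷_)
import Data.List.Relation.Unary.All as All
import Data.List.Relation.Unary.All.Properties as All
open import Data.List.Relation.Unary.AllPairs using (AllPairs; []; _∷_)
import Data.List.Relation.Unary.AllPairs.Properties as AllPairs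
import Data.List.Relation.Unary.Unique.Propositional.Properties as Unique
open import Data.List.Relation.Unary.Linked using (Linked; []; [-]; _∷_)
import Data.List.Relation.Unary.Linked as Linked
open import Data.Vec using (Vec)
import Data.Vec as Vec
import Data.Vec.Properties as Vec
open import Data.Vec.Properties using (lookup∘tabulate)
open import Data.Product using (∃-syntax; _×_; _,_)
open import Data.Sum using (_⊎_; inj₁; inj₂)
open import Function using (_∘_; id)
open import Function.Bundles using (mk⇔)
open import Relation.Binary.Definitions using (tri<; tri≈; tri>)
open import Relation.Binary.PropositionalEquality
  using (_≡_; _≢_; refl; sym; trans; cong; cong₂; subst; module ≡-Reasoning)
open import Relation.Nullary using (yes; no; ¬_)
open import Relation.Nullary.Decidable using (Dec; T?; ⌊_⌋; isYes≗does; does-⇔; dec-true; dec-false)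
open import Relation.Nullary.Negation using (contradiction)

open ≡-Reasoning

-- does (m ≟ n) and does (m <? n) compute to m ≡ᵇ n and m <ᵇ n.
≡ᵇ-refl : ∀ m → (m ≡ᵇ m) ≡ true
≡ᵇ-refl m = dec-true (m ≟ m) refl

≡ᵇ-false : ∀ {m n} → m ≢ n → (m ≡ᵇ n) ≡ false
≡ᵇ-false {m} {n} = dec-false (m ≟ n)

<ᵇ-true : ∀ {m n} → m < n → (m <ᵇ n) ≡ true
<ᵇ-true {m} {n} = dec-true (m <? n)

<ᵇ-false : ∀ {m n} → n ≤ m → (m <ᵇ n) ≡ false
<ᵇ-false {m} {n} n≤m = dec-false (m <? n) (≤⇒≯ n≤m)

<ᵇ-true⁻¹ : ∀ {m n} → (m <ᵇ n) ≡ true → m < n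
<ᵇ-true⁻¹ {m} {n} m<ᵇn = <ᵇ⇒< m n (subst T (sym m<ᵇn) tt)

⌊⌋-true : ∀ {A : Set} (a? : Dec A) → A → ⌊ a? ⌋ ≡ true
⌊⌋-true a? a = trans (isYes≗does a?) (dec-true a? a)

⌊⌋-false : ∀ {A : Set} (a? : Dec A) → ¬ A → ⌊ a? ⌋ ≡ false
⌊⌋-false a? ¬a = trans (isYes≗does a?) (dec-false a? ¬a)

filterᵇ-cong : ∀ {A : Set} {p q : A → Bool} → (∀ x → p x ≡ q x) → ∀ xs → filterᵇ p xs ≡ filterᵇ q xs
filterᵇ-cong         p≗q []       = refl
filterᵇ-cong {q = q} p≗q (x ∷ xs) rewrite p≗q x with q x
... | true  = cong (x ∷_) (filterᵇ-cong p≗q xs)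
... | false = filterᵇ-cong p≗q xs

length-filterᵇ-all : ∀ {A : Set} {p : A → Bool} xs → All (λ x → p x ≡ true) xs → length (filterᵇ p xs) ≡ length xs
length-filterᵇ-all []       []         = refl
length-filterᵇ-all (x ∷ xs) (px ∷ pxs) rewrite px = cong suc (length-filterᵇ-all xs pxs)

map-takeWhileᵇ : ∀ {A B : Set} (h : A → B) {p : A → Bool} {q : B → Bool} →
                 (∀ x → p x ≡ q (h x)) → ∀ xs → map h (takeWhileᵇ p xs) ≡ takeWhileᵇ q (map h xs)
map-takeWhileᵇ h         p≗q []       = refl
map-takeWhileᵇ h {q = q} p≗q (x ∷ xs) rewrite p≗q x with q (h x)
... | true  = cong (h x ∷_) (map-takeWhileᵇ h p≗q xs)
... | false = refl

map-iterate : ∀ {A B : Set} (h : A → B) {f : A → A} {g : B → B} →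
              (∀ x → h (f x) ≡ g (h x)) → ∀ x m → map h (iterate f x m) ≡ iterate g (h x) m
map-iterate h                 comm x zero    = refl
map-iterate h {f = f} {g = g} comm x (suc m) =
  cong (h x ∷_) (trans (map-iterate h comm (f x) m) (cong (λ y → iterate g y m) (comm x)))

tabulate-injective : ∀ {A : Set} {m} {f g : Fin m → A} → tabulate f ≡ tabulate g → ∀ i → f i ≡ g i
tabulate-injective eq zero    = ∷-injectiveˡ eq
tabulate-injective eq (suc i) = tabulate-injective (∷-injectiveʳ eq) i

tabulate-∷ʳ : ∀ {A : Set} {m} (f : Fin (suc m) → A) → tabulate f ≡ tabulate (f ∘ inject₁) ∷ʳ f (fromℕ m)
tabulate-∷ʳ {m = zero}  f = refl
tabulate-∷ʳ {m = suc m} f = cong (f zero ∷_) (tabulate-∷ʳ (f ∘ suc))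

punchIn-fromℕ : ∀ {m} (k : Fin m) → punchIn (fromℕ m) k ≡ inject₁ k
punchIn-fromℕ zero    = refl
punchIn-fromℕ (suc k) = cong suc (punchIn-fromℕ k)

-- Boundary paths of partitions

falses : List Bool → ℕ
falses []          = 0
falses (true  ∷ w) = falses w
falses (false ∷ w) = suc (falses w)

partitionOf : List Bool → List ℕ
partitionOf []          = []
partitionOf (true  ∷ w) = falses w ∷ partitionOf w
partitionOf (false ∷ w) = partitionOf w

pathOf : List ℕ → List Bool
pathOf []      = []
pathOf (x ∷ r) = true ∷ (replicate (x ∸ firstPart r) false ++ pathOf r)

bitAt : List Bool → ℕ → Bool
bitAt []      _       = false
bitAt (b ∷ w) zero    = b
bitAt (b ∷ w) (suc k) = bitAt w k

partitionOf-bounded : ∀ w → All (_≤ falses w) (partitionOf w)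
partitionOf-bounded []          = []
partitionOf-bounded (true  ∷ w) = ≤-refl ∷ partitionOf-bounded w
partitionOf-bounded (false ∷ w) = All.map (λ p → ≤-trans p (n≤1+n _)) (partitionOf-bounded w)

partitionOf-injective : ∀ w w′ → partitionOf w ≡ partitionOf w′ → falses w ≡ falses w′ → w ≡ w′
partitionOf-injective []          []           _  _  = refl
partitionOf-injective (true  ∷ w) (true  ∷ w′) eq f≡ =
  cong (true ∷_) (partitionOf-injective w w′ (∷-injectiveʳ eq) f≡)
partitionOf-injective (false ∷ w) (false ∷ w′) eq f≡ =
  cong (false ∷_) (partitionOf-injective w w′ eq (suc-injective f≡))
partitionOf-injective (true  ∷ w) (false ∷ w′) eq f≡
  with subst (All (_≤ falses w′)) (sym eq) (partitionOf-bounded w′)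
... | w≤w′ ∷ _ = contradiction (subst (_≤ falses w′) f≡ w≤w′) (<-irrefl refl)
partitionOf-injective (false ∷ w) (true  ∷ w′) eq f≡
  with subst (All (_≤ falses w)) eq (partitionOf-bounded w)
... | w′≤w ∷ _ = contradiction (subst (_≤ falses w) (sym f≡) w′≤w) (<-irrefl refl)
partitionOf-injective []          (true  ∷ w′) ()
partitionOf-injective (true  ∷ w) []           ()
partitionOf-injective []          (false ∷ w′) _  ()
partitionOf-injective (false ∷ w) []           _  ()

firstPart-≤ : ∀ {x r} → Linked _≥_ (x ∷ r) → firstPart r ≤ x
firstPart-≤ [-]       = z≤n
firstPart-≤ (y≤x ∷ _) = y≤x

falses-gap : ∀ k w → falses (replicate k false ++ w) ≡ k + falses w
falses-gap zero    w = refl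
falses-gap (suc k) w = cong suc (falses-gap k w)

partitionOf-gap : ∀ k w → partitionOf (replicate k false ++ w) ≡ partitionOf w
partitionOf-gap zero    w = refl
partitionOf-gap (suc k) w = partitionOf-gap k w

falses-pathOf : ∀ λs → Linked _≥_ λs → falses (pathOf λs) ≡ firstPart λs
falses-pathOf []      _  = refl
falses-pathOf (x ∷ r) lk = begin
  falses (replicate (x ∸ firstPart r) false ++ pathOf r) ≡⟨ falses-gap (x ∸ firstPart r) (pathOf r) ⟩
  x ∸ firstPart r + falses (pathOf r)                   ≡⟨ cong (x ∸ firstPart r +_) (falses-pathOf r (Linked.tail lk)) ⟩
  x ∸ firstPart r + firstPart r                         ≡⟨ m∸n+n≡m (firstPart-≤ lk) ⟩
  x                                                     ∎

partitionOf-pathOf : ∀ λs → Linked _≥_ λs → partitionOf (pathOf λs) ≡ λs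
partitionOf-pathOf []      _  = refl
partitionOf-pathOf (x ∷ r) lk =
  cong₂ _∷_ (falses-pathOf (x ∷ r) lk)
            (trans (partitionOf-gap (x ∸ firstPart r) (pathOf r)) (partitionOf-pathOf r (Linked.tail lk)))

length-pathOf : ∀ λs → Linked _≥_ λs → length (pathOf λs) ≡ firstPart λs + length λs
length-pathOf []      _  = refl
length-pathOf (x ∷ r) lk = begin
  suc (length (replicate (x ∸ firstPart r) false ++ pathOf r))
    ≡⟨ cong suc (length-++ (replicate (x ∸ firstPart r) false)) ⟩
  suc (length (replicate (x ∸ firstPart r) false) + length (pathOf r))
    ≡⟨ cong suc (cong₂ _+_ (length-replicate (x ∸ firstPart r)) (length-pathOf r (Linked.tail lk))) ⟩
  suc (x ∸ firstPart r + (firstPart r + length r))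
    ≡⟨ cong suc (+-assoc (x ∸ firstPart r) (firstPart r) (length r)) ⟨
  suc (x ∸ firstPart r + firstPart r + length r)
    ≡⟨ cong (λ y → suc (y + length r)) (m∸n+n≡m (firstPart-≤ lk)) ⟩
  suc (x + length r)
    ≡⟨ +-suc x (length r) ⟨
  x + suc (length r) ∎

bitAt-gap : ∀ k w j → bitAt (replicate k false ++ w) (k + j) ≡ bitAt w j
bitAt-gap zero    w j = refl
bitAt-gap (suc k) w j = bitAt-gap k w j

bitAt-falses : ∀ k j → bitAt (replicate k false) j ≡ false
bitAt-falses zero    j       = refl
bitAt-falses (suc k) zero    = refl
bitAt-falses (suc k) (suc j) = bitAt-falses k j

pathOf-last : ∀ x r → All (0 <_) (x ∷ r) → Linked _≥_ (x ∷ r) → bitAt (pathOf (x ∷ r)) (x + length r) ≡ false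
pathOf-last (suc x) []      _ _ rewrite ++-identityʳ (replicate x false) = bitAt-falses (suc x) (x + 0)
pathOf-last x       (y ∷ r) (_ ∷ pos) lk@(y≤x ∷ _) = begin
  bitAt (pathOf (x ∷ y ∷ r)) (x + suc (length r))
    ≡⟨ cong (bitAt (pathOf (x ∷ y ∷ r))) index ⟩
  bitAt (replicate (x ∸ y) false ++ pathOf (y ∷ r)) (x ∸ y + (y + length r))
    ≡⟨ bitAt-gap (x ∸ y) (pathOf (y ∷ r)) (y + length r) ⟩
  bitAt (pathOf (y ∷ r)) (y + length r)
    ≡⟨ pathOf-last y r pos (Linked.tail lk) ⟩
  false ∎
  where
  index : x + suc (length r) ≡ suc (x ∸ y + (y + length r))
  index = begin
    x + suc (length r)          ≡⟨ +-suc x (length r) ⟩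
    suc (x + length r)          ≡⟨ cong (λ z → suc (z + length r)) (m∸n+n≡m y≤x) ⟨
    suc (x ∸ y + y + length r)  ≡⟨ cong suc (+-assoc (x ∸ y) y (length r)) ⟩
    suc (x ∸ y + (y + length r)) ∎

-- Products of distinct adjacent transpositions

swap : ℕ → ℕ → ℕ
swap i j = if j ≡ᵇ i then suc i else if j ≡ᵇ suc i then i else j

swap-left : ∀ i → swap i i ≡ suc i
swap-left i rewrite ≡ᵇ-refl i = refl

swap-right : ∀ i → swap i (suc i) ≡ i
swap-right i rewrite ≡ᵇ-false (1+n≢n {i}) | ≡ᵇ-refl i = refl

swap-fixed : ∀ {i k} → k ≢ i → k ≢ suc i → swap i k ≡ k
swap-fixed k≢i k≢1+i rewrite ≡ᵇ-false k≢i | ≡ᵇ-false k≢1+i = refl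

product : List ℕ → ℕ → ℕ
product = foldr (λ i f → swap i ∘ f) id

withLetter : ℕ → (ℕ → Bool) → ℕ → Bool
withLetter i P k = (k ≡ᵇ i) ∨ P k

letters : List ℕ → ℕ → Bool
letters = foldr withLetter (λ _ → false)

-- For 0 < k, orientation w k is true iff s_{k-1} stands left of s_k in w (the leftmost of the two decides).
reorient : ℕ → (ℕ → Bool) → ℕ → Bool
reorient i D k = if k ≡ᵇ i then false else if k ≡ᵇ suc i then true else D k

orientation : List ℕ → ℕ → Bool
orientation = foldr reorient (λ _ → false)

module _ (P D : ℕ → Bool) where

  halts : ℕ → Bool
  halts k = not (P k) ∨ D k

  ascend : ℕ → ℕ → ℕ
  ascend zero    k = k
  ascend (suc f) k = if halts k then k else ascend f (suc k)

  descend : ℕ → ℕ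
  descend zero    = zero
  descend (suc j) = if not (P j) ∨ not (D (suc j)) then suc j else descend j

  movesUp : ℕ → Bool
  movesUp zero    = true
  movesUp (suc j) = not (P j) ∨ (P (suc j) ∧ D (suc j))

ascend-stop : ∀ P D f k → D k ≡ true → ascend P D f k ≡ k
ascend-stop P D zero    k _  = refl
ascend-stop P D (suc f) k Dk rewrite Dk | ∨-zeroʳ (not (P k)) = refl

descend-stop : ∀ P D k → D k ≡ false → descend P D k ≡ k
descend-stop P D zero    _  = refl
descend-stop P D (suc j) Dk rewrite Dk | ∨-zeroʳ (not (P j)) = refl

-- Closed form of the product of the distinct letters P (all below n) with orientation D;
-- n is ample fuel for ascend.
coxMap : ℕ → (P D : ℕ → Bool) → ℕ → ℕ
coxMap n P D x =
  if movesUp P D x then (if P x then ascend P D n (suc x) else x) else descend P D (pred x)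

module Prepend (n : ℕ) (P D : ℕ → Bool) {i : ℕ} (i<n : i < n) (i∉P : P i ≡ false) where

  P′ D′ : ℕ → Bool
  P′ = withLetter i P
  D′ = reorient i D

  P′-other : ∀ {k} → k ≢ i → P′ k ≡ P k
  P′-other k≢i rewrite ≡ᵇ-false k≢i = refl

  swap-if : ∀ b {x y} → (if b then swap i x else swap i y) ≡ swap i (if b then x else y)
  swap-if b = sym (if-float (swap i) b)

  D′-fresh : D′ i ≡ false
  D′-fresh rewrite ≡ᵇ-refl i = refl

  D′-next : D′ (suc i) ≡ true
  D′-next rewrite ≡ᵇ-false (1+n≢n {i}) | ≡ᵇ-refl i = refl

  ascend-prepend : ∀ f k → n ≤ k + f → k ≢ suc i → ascend P′ D′ f k ≡ swap i (ascend P D f k)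
  ascend-prepend f k fuel k≢1+i with k ≟ i
  ascend-prepend zero    k fuel _ | yes refl =
    contradiction (subst (n ≤_) (+-identityʳ k) fuel) (<⇒≱ i<n)
  ascend-prepend (suc f) k fuel _ | yes refl rewrite i∉P | ≡ᵇ-refl i = ascend-stop P′ D′ f (suc i) D′-next
  ascend-prepend zero    k fuel k≢1+i | no k≢i = sym (swap-fixed k≢i k≢1+i)
  ascend-prepend (suc f) k fuel k≢1+i | no k≢i rewrite ≡ᵇ-false k≢i | ≡ᵇ-false k≢1+i =
    trans (cong₂ (if_then_else_ (not (P k) ∨ D k))
                 (sym (swap-fixed k≢i k≢1+i))
                 (ascend-prepend f (suc k) (subst (n ≤_) (+-suc k f) fuel) (k≢i ∘ suc-injective)))
          (swap-if (not (P k) ∨ D k))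

  descend-prepend : ∀ k → k ≢ i → descend P′ D′ k ≡ swap i (descend P D k)
  descend-prepend zero    0≢i = sym (swap-fixed 0≢i (λ ()))
  descend-prepend (suc j) 1+j≢i with j ≟ i
  ... | yes refl rewrite i∉P | ≡ᵇ-false (1+n≢n {i}) | ≡ᵇ-refl i = descend-stop P′ D′ i D′-fresh
  ... | no j≢i rewrite ≡ᵇ-false j≢i | ≡ᵇ-false 1+j≢i =
    trans (cong₂ (if_then_else_ (not (P j) ∨ not (D (suc j))))
                 (sym (swap-fixed 1+j≢i (j≢i ∘ suc-injective)))
                 (descend-prepend j j≢i))
          (swap-if (not (P j) ∨ not (D (suc j))))

  movesUp-other : ∀ {x} → x ≢ i → x ≢ suc i → movesUp P′ D′ x ≡ movesUp P D x
  movesUp-other {zero}  _   _     = refl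
  movesUp-other {suc j} x≢i x≢1+i rewrite ≡ᵇ-false (x≢1+i ∘ cong suc) | ≡ᵇ-false x≢i = refl

  swap-branches : ∀ m p {a x d} → swap i x ≡ x →
    swap i (if m then (if p then a else x) else d) ≡ (if m then (if p then swap i a else x) else swap i d)
  swap-branches true  true  _  = refl
  swap-branches true  false fx = fx
  swap-branches false _     _  = refl

  coxMap-fresh : ∀ x → x ≡ i → coxMap n P′ D′ x ≡ swap i (coxMap n P D x)
  coxMap-fresh zero    refl rewrite i∉P = ascend-stop P′ D′ n 1 refl
  coxMap-fresh (suc j) refl rewrite i∉P | ≡ᵇ-false (1+n≢n {j} ∘ sym) | ≡ᵇ-refl j =
    trans (cong₂ (if_then_else_ (not (P j) ∨ false))
                 (trans (ascend-stop P′ D′ n (suc (suc j)) D′-next) (sym (swap-left (suc j))))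
                 (descend-prepend j (1+n≢n ∘ sym)))
          (swap-if (not (P j) ∨ false))

  coxMap-next : coxMap n P′ D′ (suc i) ≡ swap i (coxMap n P D (suc i))
  coxMap-next rewrite i∉P | ≡ᵇ-false (1+n≢n {i}) | ≡ᵇ-refl i | ∧-identityʳ (P (suc i)) with P (suc i)
  ... | true  = ascend-prepend n (suc (suc i)) (m≤n+m n (suc (suc i))) (1+n≢n)
  ... | false = trans (descend-stop P′ D′ i D′-fresh) (sym (swap-right i))

  coxMap-prepend : ∀ x → coxMap n P′ D′ x ≡ swap i (coxMap n P D x)
  coxMap-prepend x with x ≟ i | x ≟ suc i
  ... | yes x≡i | _        = coxMap-fresh x x≡i
  ... | no _    | yes refl = coxMap-next
  ... | no x≢i  | no x≢1+i = begin
    coxMap n P′ D′ x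
      ≡⟨ cong₂ (λ m p → if m then (if p then ascend P′ D′ n (suc x) else x) else descend P′ D′ (pred x))
               (movesUp-other x≢i x≢1+i) (P′-other x≢i) ⟩
    (if movesUp P D x then (if P x then ascend P′ D′ n (suc x) else x) else descend P′ D′ (pred x))
      ≡⟨ cong₂ (λ a d → if movesUp P D x then (if P x then a else x) else d)
               (ascend-prepend n (suc x) (m≤n+m n (suc x)) (x≢i ∘ suc-injective))
               (descend-prepend (pred x) (pred≢ x x≢i x≢1+i)) ⟩
    (if movesUp P D x then (if P x then swap i (ascend P D n (suc x)) else x) else swap i (descend P D (pred x)))
      ≡⟨ sym (swap-branches (movesUp P D x) (P x) (swap-fixed x≢i x≢1+i)) ⟩
    swap i (coxMap n P D x) ∎
    where
    pred≢ : ∀ x → x ≢ i → x ≢ suc i → pred x ≢ i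
    pred≢ zero    x≢i _     = x≢i
    pred≢ (suc y) _   x≢1+i = x≢1+i ∘ cong suc

letters-absent : ∀ {k} w → All (k ≢_) w → letters w k ≡ false
letters-absent []      []             = refl
letters-absent (j ∷ w) (k≢j ∷ k∉w) rewrite ≡ᵇ-false k≢j = letters-absent w k∉w

letters-present : ∀ {k} w → k ∈ w → letters w k ≡ true
letters-present     (j ∷ w) (here refl) rewrite ≡ᵇ-refl j = refl
letters-present {k} (j ∷ w) (there k∈w) rewrite letters-present w k∈w = ∨-zeroʳ (k ≡ᵇ j)

product≡coxMap : ∀ n w → All (_< n) w → AllPairs _≢_ w →
                 ∀ x → product w x ≡ coxMap n (letters w) (orientation w) x
product≡coxMap n []      []          []          zero    = refl
product≡coxMap n []      []          []          (suc x) = refl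
product≡coxMap n (i ∷ w) (i<n ∷ w<n) (i∉w ∷ w!) x =
  trans (cong (swap i) (product≡coxMap n w w<n w! x))
        (sym (Prepend.coxMap-prepend n (letters w) (orientation w) i<n (letters-absent w i∉w) x))

module Full (n : ℕ) {P P′ D D′ : ℕ → Bool}
            (P-full : ∀ k → P k ≡ (k <ᵇ n)) (P′-full : ∀ k → P′ k ≡ (k <ᵇ n))
            (D≡D′ : ∀ k → 0 < k → k < n → D k ≡ D′ k) where

  ascend-cong : ∀ f k → 0 < k → ascend P D f k ≡ ascend P′ D′ f k
  ascend-cong zero    k _   = refl
  ascend-cong (suc f) k 0<k rewrite P-full k | P′-full k with k <? n
  ... | yes k<n rewrite <ᵇ-true k<n | D≡D′ k 0<k k<n =
    cong (if_then_else_ (D′ k) k) (ascend-cong f (suc k) z<s)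
  ... | no  k≮n rewrite <ᵇ-false (≮⇒≥ k≮n) = refl

  descend-cong : ∀ k → k < n → descend P D k ≡ descend P′ D′ k
  descend-cong zero    _   = refl
  descend-cong (suc j) j<n rewrite P-full j | P′-full j | <ᵇ-true (<⇒≤ j<n) | D≡D′ (suc j) z<s j<n =
    cong (if_then_else_ (not (D′ (suc j))) (suc j)) (descend-cong j (<⇒≤ j<n))

  movesUp-cong : ∀ x → movesUp P D x ≡ movesUp P′ D′ x
  movesUp-cong zero = refl
  movesUp-cong (suc j) rewrite P-full j | P′-full j | P-full (suc j) | P′-full (suc j) with suc j <? n
  ... | yes j<n rewrite <ᵇ-true j<n | D≡D′ (suc j) z<s j<n = refl
  ... | no  j≮n rewrite <ᵇ-false (≮⇒≥ j≮n) = refl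

  coxMap-cong : ∀ x → x ≤ n → coxMap n P D x ≡ coxMap n P′ D′ x
  coxMap-cong zero    _ rewrite P-full 0 | P′-full 0 | ascend-cong n 1 z<s = refl
  coxMap-cong (suc y) y<n
    rewrite movesUp-cong (suc y) | P-full (suc y) | P′-full (suc y)
          | ascend-cong n (suc (suc y)) z<s | descend-cong y y<n = refl

-- The orbit of 0

module _ (P D : ℕ → Bool) where

  ascend-≥ : ∀ f k → k ≤ ascend P D f k
  ascend-≥ zero    k = ≤-refl
  ascend-≥ (suc f) k with halts P D k
  ... | true  = ≤-refl
  ... | false = ≤-trans (n≤1+n k) (ascend-≥ f (suc k))

  ascend-skips : ∀ f k t → k ≤ t → t < ascend P D f k → halts P D t ≡ false
  ascend-skips zero    k t k≤t t<k = contradiction t<k (≤⇒≯ k≤t)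
  ascend-skips (suc f) k t k≤t t<j with halts P D k in stop
  ... | true  = contradiction t<j (≤⇒≯ k≤t)
  ... | false with t ≟ k
  ...   | yes refl = stop
  ...   | no  t≢k  = ascend-skips f (suc k) t (≤∧≢⇒< k≤t (t≢k ∘ sym)) t<j

  ascend-halts : ∀ f k → halts P D (k + f) ≡ true → halts P D (ascend P D f k) ≡ true
  ascend-halts zero    k stop = subst (λ t → halts P D t ≡ true) (+-identityʳ k) stop
  ascend-halts (suc f) k stop with halts P D k in stopₖ
  ... | true  = stopₖ
  ... | false = ascend-halts f (suc k) (subst (λ t → halts P D t ≡ true) (+-suc k f) stop)

  ascend-≤ : ∀ {n} → (∀ t → P t ≡ true → t < n) → ∀ f k → k ≤ n → ascend P D f k ≤ n
  ascend-≤ P⊆n zero    k k≤n = k≤n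
  ascend-≤ P⊆n (suc f) k k≤n with P k in present
  ... | false = k≤n
  ... | true with D k
  ...   | true  = k≤n
  ...   | false = ascend-≤ P⊆n f (suc k) (P⊆n k present)

module Orbit (n : ℕ) (D : ℕ → Bool) where

  P : ℕ → Bool
  P k = k <ᵇ n

  g : ℕ → ℕ
  g = coxMap n P D

  risesAbove : ℕ → ℕ → Bool
  risesAbove k x = (k <ᵇ x) ∧ ((x <ᵇ n) ∧ D x)

  risesAbove-false : ∀ {k x} → (k < x → x < n → D x ≡ false) → risesAbove k x ≡ false
  risesAbove-false {k} {x} D-off with k <? x | x <? n
  ... | no  k≮x | _       rewrite <ᵇ-false (≮⇒≥ k≮x) = refl
  ... | yes k<x | no  x≮n rewrite <ᵇ-true k<x | <ᵇ-false (≮⇒≥ x≮n) = refl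
  ... | yes k<x | yes x<n rewrite <ᵇ-true k<x | <ᵇ-true x<n = D-off k<x x<n

  record Ascent (k j : ℕ) : Set where
    field
      k<j     : k < j
      skipped : ∀ t → k < t → t < j → D t ≡ false
      j≤n     : j ≤ n
      lands   : j < n → D j ≡ true

  ascent : ∀ k → k < n → Ascent k (ascend P D n (suc k))
  ascent k k<n = record
    { k<j     = ascend-≥ P D n (suc k)
    ; skipped = λ t k<t t<j → skip-off (t <ᵇ n) (ascend-skips P D n (suc k) t k<t t<j)
    ; j≤n     = ascend-≤ P D (λ t → <ᵇ-true⁻¹) n (suc k) k<n
    ; lands   = λ j<n → halted (ascend-halts P D n (suc k) beyond) (<ᵇ-true j<n)
    }
    where
    beyond : halts P D (suc k + n) ≡ true
    beyond rewrite <ᵇ-false (m≤n+m n (suc k)) = refl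
    skip-off : ∀ {t} b → (not b ∨ D t) ≡ false → D t ≡ false
    skip-off true  off = off
    skip-off false ()
    halted : ∀ {t b} → (not b ∨ D t) ≡ true → b ≡ true → D t ≡ true
    halted stop refl = stop

  risesAbove-step : ∀ {k j} x → Ascent k j → j < n → ((x ≡ᵇ j) ∨ risesAbove j x) ≡ risesAbove k x
  risesAbove-step {k} {j} x asc j<n with <-cmp x j
  ... | tri< x<j _ _ rewrite ≡ᵇ-false (<⇒≢ x<j) | <ᵇ-false (<⇒≤ x<j) =
    sym (risesAbove-false (λ k<x x<n → Ascent.skipped asc x k<x x<j))
  ... | tri≈ _ refl _ rewrite ≡ᵇ-refl x | <ᵇ-true (Ascent.k<j asc) | <ᵇ-true j<n | Ascent.lands asc j<n = refl
  ... | tri> _ _ j<x rewrite ≡ᵇ-false (>⇒≢ j<x) | <ᵇ-true j<x | <ᵇ-true (<-trans (Ascent.k<j asc) j<x) = refl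

  g-ascends : ∀ k → k < n → k ≡ 0 ⊎ D k ≡ true → g k ≡ ascend P D n (suc k)
  g-ascends zero    0<n _          rewrite <ᵇ-true 0<n = refl
  g-ascends (suc j) k<n (inj₂ Dk) rewrite <ᵇ-true k<n | Dk | ∨-zeroʳ (not (j <ᵇ n)) = refl

  orbit : ℕ → ℕ → List ℕ
  orbit m k = takeWhileᵇ (λ y → not (y ≡ᵇ n)) (iterate g (g k) m)

  orbit-members : ∀ m k → k < n → k ≡ 0 ⊎ D k ≡ true → n ≤ k + m →
                  ∀ x → any (x ≡ᵇ_) (orbit m k) ≡ risesAbove k x
  orbit-members zero    k k<n _      fuel x = contradiction (subst (n ≤_) (+-identityʳ k) fuel) (<⇒≱ k<n)
  orbit-members (suc m) k k<n rising fuel x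
    rewrite g-ascends k k<n rising = from (ascend P D n (suc k)) (ascent k k<n)
    where
    from : ∀ j → Ascent k j → any (x ≡ᵇ_) (takeWhileᵇ (λ y → not (y ≡ᵇ n)) (iterate g j (suc m))) ≡ risesAbove k x
    from j asc with j ≟ n
    ... | yes refl rewrite ≡ᵇ-refl n = sym (risesAbove-false (λ k<x x<n → Ascent.skipped asc x k<x x<n))
    ... | no  j≢n rewrite ≡ᵇ-false j≢n =
      trans (cong ((x ≡ᵇ j) ∨_) (orbit-members m j j<n (inj₂ (Ascent.lands asc j<n)) fuel′ x))
            (risesAbove-step x asc j<n)
      where
      j<n : j < n
      j<n = ≤∧≢⇒< (Ascent.j≤n asc) j≢n
      fuel′ : n ≤ j + m
      fuel′ = ≤-trans (subst (n ≤_) (+-suc k m) fuel) (+-monoˡ-≤ m (Ascent.k<j asc))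

-- Coxeter elements of 𝔖_{n+1}

isYes-≟-toℕ : ∀ {m} (x y : Fin m) → ⌊ x F.≟ y ⌋ ≡ (toℕ x ≡ᵇ toℕ y)
isYes-≟-toℕ x y =
  trans (isYes≗does (x F.≟ y)) (does-⇔ (mk⇔ (cong toℕ) toℕ-injective) (x F.≟ y) (toℕ x ≟ toℕ y))

toℕ-s : ∀ {n} (i : Fin n) (j : Fin (suc n)) → toℕ (s i j) ≡ swap (toℕ i) (toℕ j)
toℕ-s i j with j F.≟ inject₁ i | j F.≟ suc i
... | yes refl | _ rewrite toℕ-inject₁ i | ≡ᵇ-refl (toℕ i) = refl
... | no _     | yes refl rewrite ≡ᵇ-false (1+n≢n {toℕ i}) | ≡ᵇ-refl (toℕ i) = toℕ-inject₁ i
... | no j≢i   | no j≢1+i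
  rewrite ≡ᵇ-false (j≢i ∘ toℕ-injective ∘ (λ e → trans e (sym (toℕ-inject₁ i))))
        | ≡ᵇ-false (j≢1+i ∘ toℕ-injective) = refl

module _ {n : ℕ} (σ : Permutation′ n) where

  word : List ℕ
  word = map (λ i → toℕ (σ ⟨$⟩ʳ i)) (allFin n)

  toℕ-coxProd : ∀ x → toℕ (coxProd σ x) ≡ product word (toℕ x)
  toℕ-coxProd x = go (allFin n)
    where
    sσ : Fin n → (Fin (suc n) → Fin (suc n)) → Fin (suc n) → Fin (suc n)
    sσ i f = s (σ ⟨$⟩ʳ i) ∘ f
    go : ∀ is → toℕ (foldr sσ id is x) ≡ product (map (λ i → toℕ (σ ⟨$⟩ʳ i)) is) (toℕ x)
    go []       = refl
    go (i ∷ is) = trans (toℕ-s (σ ⟨$⟩ʳ i) (foldr sσ id is x)) (cong (swap (toℕ (σ ⟨$⟩ʳ i))) (go is))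

  word-bounded : All (_< n) word
  word-bounded = All.map⁺ (All.universal (λ i → toℕ<n (σ ⟨$⟩ʳ i)) (allFin n))

  word-distinct : AllPairs _≢_ word
  word-distinct = Unique.map⁺ injective (Unique.allFin⁺ n)
    where
    injective : ∀ {i j} → toℕ (σ ⟨$⟩ʳ i) ≡ toℕ (σ ⟨$⟩ʳ j) → i ≡ j
    injective {i} {j} eq = begin
      i                     ≡⟨ inverseˡ σ ⟨
      σ ⟨$⟩ˡ (σ ⟨$⟩ʳ i)     ≡⟨ cong (σ ⟨$⟩ˡ_) (toℕ-injective eq) ⟩
      σ ⟨$⟩ˡ (σ ⟨$⟩ʳ j)     ≡⟨ inverseˡ σ ⟩
      j                     ∎

  word-complete : ∀ {k} → k < n → k ∈ word
  word-complete k<n =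
    subst (_∈ word) (trans (cong toℕ (inverseʳ σ)) (toℕ-fromℕ< k<n))
          (∈-map⁺ (λ i → toℕ (σ ⟨$⟩ʳ i)) (∈-allFin (σ ⟨$⟩ˡ fromℕ< k<n)))

  letters-word : ∀ k → letters word k ≡ (k <ᵇ n)
  letters-word k with k <? n
  ... | yes k<n rewrite <ᵇ-true k<n = letters-present word (word-complete k<n)
  ... | no  k≮n rewrite <ᵇ-false (≮⇒≥ k≮n) =
    letters-absent word (All.map (λ j<n k≡j → k≮n (subst (_< n) (sym k≡j) j<n)) word-bounded)

  toℕ-coxProd≡coxMap : ∀ x → toℕ (coxProd σ x) ≡ coxMap n (_<ᵇ n) (orientation word) (toℕ x)
  toℕ-coxProd≡coxMap x = begin
    toℕ (coxProd σ x)
      ≡⟨ toℕ-coxProd x ⟩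
    product word (toℕ x)
      ≡⟨ product≡coxMap n word word-bounded word-distinct (toℕ x) ⟩
    coxMap n (letters word) (orientation word) (toℕ x)
      ≡⟨ Full.coxMap-cong n letters-word (λ _ → refl) (λ _ _ _ → refl) (toℕ x) (toℕ≤pred[n] x) ⟩
    coxMap n (_<ᵇ n) (orientation word) (toℕ x) ∎

∈ᵇ-toℕ : ∀ {m} (x : Fin m) xs → (x ∈ᵇ xs) ≡ any (toℕ x ≡ᵇ_) (map toℕ xs)
∈ᵇ-toℕ x xs = cong or (trans (map-cong (isYes-≟-toℕ x) xs) (map-∘ xs))

reorient-shift : ∀ b w k → foldr reorient b (map suc w) (suc k) ≡ foldr reorient (b ∘ suc) w k
reorient-shift b []      k = refl
reorient-shift b (i ∷ w) k rewrite reorient-shift b w k = refl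

reorient-zero : ∀ b w → 0 ∈ w → foldr reorient b w 0 ≡ false
reorient-zero b (zero  ∷ w) _           = refl
reorient-zero b (suc i ∷ w) (there 0∈w) = reorient-zero b w 0∈w

module _ {m : ℕ} (τ : Permutation′ m) where

  word-insert-front : word (insert zero zero τ) ≡ 0 ∷ map suc (word τ)
  word-insert-front = cong (0 ∷_) (begin
    map (λ i → toℕ (insert zero zero τ ⟨$⟩ʳ i)) (tabulate suc)  ≡⟨ map-tabulate suc _ ⟩
    tabulate (λ i → suc (toℕ (τ ⟨$⟩ʳ i)))                      ≡⟨ map-tabulate id (λ i → suc (toℕ (τ ⟨$⟩ʳ i))) ⟨
    map (λ i → suc (toℕ (τ ⟨$⟩ʳ i))) (allFin m)                ≡⟨ map-∘ (allFin m) ⟩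
    map suc (word τ)                                           ∎)

  word-insert-back : word (insert (fromℕ m) zero τ) ≡ map suc (word τ) ∷ʳ 0
  word-insert-back = begin
    map (toℕ ∘ (π ⟨$⟩ʳ_)) (allFin (suc m))                       ≡⟨ map-tabulate id (toℕ ∘ (π ⟨$⟩ʳ_)) ⟩
    tabulate (toℕ ∘ (π ⟨$⟩ʳ_))                                   ≡⟨ tabulate-∷ʳ (toℕ ∘ (π ⟨$⟩ʳ_)) ⟩
    tabulate (toℕ ∘ (π ⟨$⟩ʳ_) ∘ inject₁) ∷ʳ toℕ (π ⟨$⟩ʳ fromℕ m)  ≡⟨ cong₂ _∷ʳ_ (tabulate-cong shifted) last ⟩
    tabulate (λ i → suc (toℕ (τ ⟨$⟩ʳ i))) ∷ʳ 0                    ≡⟨ cong (_∷ʳ 0) (map-tabulate id (λ i → suc (toℕ (τ ⟨$⟩ʳ i)))) ⟨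
    map (λ i → suc (toℕ (τ ⟨$⟩ʳ i))) (allFin m) ∷ʳ 0              ≡⟨ cong (_∷ʳ 0) (map-∘ (allFin m)) ⟩
    map suc (word τ) ∷ʳ 0                                        ∎
    where
    π : Permutation′ (suc m)
    π = insert (fromℕ m) zero τ
    shifted : ∀ i → toℕ (π ⟨$⟩ʳ inject₁ i) ≡ suc (toℕ (τ ⟨$⟩ʳ i))
    shifted i = cong toℕ (trans (cong (π ⟨$⟩ʳ_) (sym (punchIn-fromℕ i))) (insert-punchIn (fromℕ m) zero τ i))
    -- π ⟨$⟩ˡ zero computes to fromℕ m
    last : toℕ (π ⟨$⟩ʳ fromℕ m) ≡ 0
    last = cong toℕ (inverseʳ π {zero})

-- The letter 0 is placed first (making s_0 left of s_1) or last, next to a realization of the shifted orientation.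
realization : ∀ m → (ℕ → Bool) → Permutation′ m
realization zero    D = FP.id
realization (suc m) D = insert (if D 1 then zero else fromℕ m) zero (realization m (D ∘ suc))

realization-orientation : ∀ m D b k → 0 < k → k < m → foldr reorient b (word (realization m D)) k ≡ D k
realization-orientation (suc m) D b k 0<k k<1+m with D 1 in D₁
... | true  = trans (cong (λ w → foldr reorient b w k) (word-insert-front τ)) (front k 0<k k<1+m)
  where
  τ : Permutation′ m
  τ = realization m (D ∘ suc)
  front : ∀ k → 0 < k → k < suc m → foldr reorient b (0 ∷ map suc (word τ)) k ≡ D k
  front 1             _ _         = sym D₁
  front (suc (suc k)) _ (s≤s k<m) =
    trans (reorient-shift b (word τ) (suc k)) (realization-orientation m (D ∘ suc) (b ∘ suc) (suc k) z<s k<m)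
... | false = trans (cong (λ w → foldr reorient b w k) (word-insert-back τ)) (back k 0<k k<1+m)
  where
  τ : Permutation′ m
  τ = realization m (D ∘ suc)
  b′ : ℕ → Bool
  b′ = reorient 0 b ∘ suc
  shifted : ∀ k → foldr reorient b (map suc (word τ) ∷ʳ 0) (suc k) ≡ foldr reorient b′ (word τ) k
  shifted k = trans (cong (λ f → f (suc k)) (foldr-∷ʳ reorient b 0 (map suc (word τ))))
                    (reorient-shift (reorient 0 b) (word τ) k)
  back : ∀ k → 0 < k → k < suc m → foldr reorient b (map suc (word τ) ∷ʳ 0) k ≡ D k
  back 1             _ (s≤s 0<m) = trans (shifted 0) (trans (reorient-zero b′ (word τ) (word-complete τ 0<m)) (sym D₁))
  back (suc (suc k)) _ (s≤s k<m) = trans (shifted (suc k)) (realization-orientation m (D ∘ suc) b′ (suc k) z<s k<m)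

-- Reading off λ(c)

module _ {m : ℕ} (b : Fin m → Bool) where

  length-filterᵇ-not : ∀ xs → length (filterᵇ (not ∘ b) xs) ≡ falses (map b xs)
  length-filterᵇ-not []       = refl
  length-filterᵇ-not (x ∷ xs) with b x
  ... | true  = length-filterᵇ-not xs
  ... | false = cong suc (length-filterᵇ-not xs)

  countAbove : Fin m → List (Fin m) → ℕ
  countAbove a rs = length (filterᵇ (λ r → ⌊ a F.<? r ⌋) rs)

  countAbove-below : ∀ {a x} rs → x Fin.< a → countAbove a (x ∷ rs) ≡ countAbove a rs
  countAbove-below {a} {x} rs x<a rewrite ⌊⌋-false (a F.<? x) (F.<-asym x<a) = refl

  countAbove-partitionOf : ∀ xs → AllPairs Fin._<_ xs →
    map (λ a → countAbove a (filterᵇ (not ∘ b) xs)) (filterᵇ b xs) ≡ partitionOf (map b xs)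
  countAbove-partitionOf []       []               = refl
  countAbove-partitionOf (x ∷ xs) (x<xs ∷ sorted) with b x
  ... | true  = cong₂ _∷_
    (trans (length-filterᵇ-all _ (All.map (⌊⌋-true (x F.<? _)) (All.filter⁺ (T? ∘ (not ∘ b)) x<xs)))
           (length-filterᵇ-not xs))
    (countAbove-partitionOf xs sorted)
  ... | false = trans
    (map-cong-local (All.map (countAbove-below (filterᵇ (not ∘ b) xs)) (All.filter⁺ (T? ∘ b) x<xs)))
    (countAbove-partitionOf xs sorted)

-- Membership of k in L_c ∪ {0}, i.e. in Aset c, by the orbit computation below.
inA : ℕ → (ℕ → Bool) → ℕ → Bool
inA n D k = (k ≡ᵇ 0) ∨ Orbit.risesAbove n D 0 k

pathA : ∀ n → (ℕ → Bool) → List Bool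
pathA n D = map (λ (i : Fin (suc n)) → inA n D (toℕ i)) (allFin (suc n))

module CoxeterElement {n : ℕ} (0<n : 0 < n) (σ : Permutation′ n) where

  D : ℕ → Bool
  D = orientation (word σ)

  c : Vec (Fin (suc n)) (suc n)
  c = Vec.tabulate (coxProd σ)

  open Orbit n D

  toℕ-lookup : ∀ x → toℕ (Vec.lookup c x) ≡ g (toℕ x)
  toℕ-lookup x = trans (cong toℕ (lookup∘tabulate (coxProd σ) x)) (toℕ-coxProd≡coxMap σ x)

  Lset-toℕ : map toℕ (Lset c) ≡ orbit n 0
  Lset-toℕ = begin
    map toℕ (takeWhileᵇ (λ x → not ⌊ x F.≟ fromℕ n ⌋) (iterate (Vec.lookup c) (Vec.lookup c zero) n))
      ≡⟨ map-takeWhileᵇ toℕ {q = notLast} (λ x → cong not (trans (isYes-≟-toℕ x (fromℕ n)) (cong (toℕ x ≡ᵇ_) (toℕ-fromℕ n))))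
                        (iterate (Vec.lookup c) (Vec.lookup c zero) n) ⟩
    takeWhileᵇ notLast (map toℕ (iterate (Vec.lookup c) (Vec.lookup c zero) n))
      ≡⟨ cong (takeWhileᵇ notLast) (map-iterate toℕ toℕ-lookup (Vec.lookup c zero) n) ⟩
    takeWhileᵇ notLast (iterate g (toℕ (Vec.lookup c zero)) n)
      ≡⟨ cong (λ y → takeWhileᵇ notLast (iterate g y n)) (toℕ-lookup zero) ⟩
    orbit n 0 ∎
    where
    notLast : ℕ → Bool
    notLast y = not (y ≡ᵇ n)

  Lset-member : ∀ x → (x ∈ᵇ Lset c) ≡ risesAbove 0 (toℕ x)
  Lset-member x = begin
    x ∈ᵇ Lset c                         ≡⟨ ∈ᵇ-toℕ x (Lset c) ⟩
    any (toℕ x ≡ᵇ_) (map toℕ (Lset c))  ≡⟨ cong (any (toℕ x ≡ᵇ_)) Lset-toℕ ⟩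
    any (toℕ x ≡ᵇ_) (orbit n 0)         ≡⟨ orbit-members n 0 0<n (inj₁ refl) ≤-refl (toℕ x) ⟩
    risesAbove 0 (toℕ x)                ∎

  isA : Fin (suc n) → Bool
  isA x = ⌊ x F.≟ zero ⌋ ∨ (x ∈ᵇ Lset c)

  lam≡partitionOf : lam c ≡ partitionOf (pathA n D)
  lam≡partitionOf = begin
    lam c
      ≡⟨ cong (λ rs → map (λ a → countAbove isA a rs) (Aset c)) (filterᵇ-cong deMorgan (allFin (suc n))) ⟩
    map (λ a → countAbove isA a (filterᵇ (not ∘ isA) (allFin (suc n)))) (filterᵇ isA (allFin (suc n)))
      ≡⟨ countAbove-partitionOf isA (allFin (suc n)) (AllPairs.tabulate⁺-< id) ⟩
    partitionOf (map isA (allFin (suc n)))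
      ≡⟨ cong partitionOf (map-cong (λ x → cong₂ _∨_ (isYes-≟-toℕ x zero) (Lset-member x)) (allFin (suc n))) ⟩
    partitionOf (pathA n D) ∎
    where
    deMorgan : ∀ x → (not ⌊ x F.≟ zero ⌋ ∧ not (x ∈ᵇ Lset c)) ≡ not (isA x)
    deMorgan x with ⌊ x F.≟ zero ⌋
    ... | true  = refl
    ... | false = refl

inA-inner : ∀ {n} D {k} → 0 < k → k < n → inA n D k ≡ D k
inA-inner D {suc k} _ k<n rewrite <ᵇ-true k<n = refl

inA-determined : ∀ {n D} (f : ℕ → Bool) → 0 < n → f 0 ≡ true → f n ≡ false →
                 (∀ k → 0 < k → k < n → D k ≡ f k) → ∀ k → k ≤ n → inA n D k ≡ f k
inA-determined         f 0<n f₀ fₙ D≡f zero    _   = sym f₀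
inA-determined {n} {D} f 0<n f₀ fₙ D≡f (suc k) k<n with suc k <? n
... | yes 1+k<n = trans (inA-inner D z<s 1+k<n) (D≡f (suc k) z<s 1+k<n)
... | no  1+k≮n rewrite ≤-antisym k<n (≮⇒≥ 1+k≮n) | <ᵇ-false (≤-refl {n}) = sym fₙ

tabulate-bitAt : ∀ w → tabulate (λ (i : Fin (length w)) → bitAt w (toℕ i)) ≡ w
tabulate-bitAt []      = refl
tabulate-bitAt (b ∷ w) = cong (b ∷_) (tabulate-bitAt w)

pathA-injective : ∀ {n D D′} → pathA n D ≡ pathA n D′ → ∀ k → 0 < k → k < n → D k ≡ D′ k
pathA-injective {n} {D} {D′} eq k 0<k k<n = begin
  D k                            ≡⟨ inA-inner D 0<k k<n ⟨
  inA n D k                      ≡⟨ cong (inA n D) (toℕ-fromℕ< k<1+n) ⟨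
  inA n D (toℕ (fromℕ< k<1+n))   ≡⟨ tabulate-injective {f = inA n D ∘ toℕ} {g = inA n D′ ∘ toℕ} tabulates≡ (fromℕ< k<1+n) ⟩
  inA n D′ (toℕ (fromℕ< k<1+n))  ≡⟨ cong (inA n D′) (toℕ-fromℕ< k<1+n) ⟩
  inA n D′ k                     ≡⟨ inA-inner D′ 0<k k<n ⟩
  D′ k                           ∎
  where
  k<1+n : k < suc n
  k<1+n = m≤n⇒m≤1+n k<n
  tabulates≡ : tabulate (λ (i : Fin (suc n)) → inA n D (toℕ i)) ≡ tabulate (λ i → inA n D′ (toℕ i))
  tabulates≡ = trans (sym (map-tabulate id (inA n D ∘ toℕ))) (trans eq (map-tabulate id (inA n D′ ∘ toℕ)))

coxeter-unique : ∀ {n} → 0 < n → (σ σ′ : Permutation′ n) →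
                 lam (Vec.tabulate (coxProd σ)) ≡ lam (Vec.tabulate (coxProd σ′)) →
                 Vec.tabulate (coxProd σ) ≡ Vec.tabulate (coxProd σ′)
coxeter-unique {n} 0<n σ σ′ lam≡ = Vec.tabulate-cong (λ x → toℕ-injective (begin
  toℕ (coxProd σ x)              ≡⟨ toℕ-coxProd≡coxMap σ x ⟩
  coxMap n (_<ᵇ n) C.D (toℕ x)   ≡⟨ Full.coxMap-cong n (λ _ → refl) (λ _ → refl) D≡D′ (toℕ x) (toℕ≤pred[n] x) ⟩
  coxMap n (_<ᵇ n) C′.D (toℕ x)  ≡⟨ toℕ-coxProd≡coxMap σ′ x ⟨
  toℕ (coxProd σ′ x)             ∎))
  where
  module C  = CoxeterElement 0<n σ
  module C′ = CoxeterElement 0<n σ′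
  partitions≡ : partitionOf (pathA n C.D) ≡ partitionOf (pathA n C′.D)
  partitions≡ = trans (sym C.lam≡partitionOf) (trans lam≡ C′.lam≡partitionOf)
  -- both paths start with true, so the first parts of the partitions count their falses
  D≡D′ : ∀ k → 0 < k → k < n → C.D k ≡ C′.D k
  D≡D′ = pathA-injective (partitionOf-injective _ _ partitions≡ (∷-injectiveˡ partitions≡))

coxeter-exists : ∀ {n} → 0 < n → ∀ λs → IsPartition λs → firstPart λs + length λs ≡ suc n →
                 lam (Vec.tabulate (coxProd (realization n (bitAt (pathOf λs))))) ≡ λs
coxeter-exists {n} 0<n (x ∷ r) (pos , lk) size = begin
  lam C.c                    ≡⟨ C.lam≡partitionOf ⟩
  partitionOf (pathA n C.D)  ≡⟨ cong partitionOf pathA≡w ⟩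
  partitionOf w              ≡⟨ partitionOf-pathOf (x ∷ r) lk ⟩
  x ∷ r                      ∎
  where
  w : List Bool
  w = pathOf (x ∷ r)
  module C = CoxeterElement 0<n (realization n (bitAt w))
  length-w : length w ≡ suc n
  length-w = trans (length-pathOf (x ∷ r) lk) size
  last : bitAt w n ≡ false
  last = subst (λ i → bitAt w i ≡ false) (suc-injective (trans (sym (+-suc x (length r))) size))
               (pathOf-last x r pos lk)
  pathA≡w : pathA n C.D ≡ w
  pathA≡w = begin
    pathA n C.D
      ≡⟨ map-cong (λ i → inA-determined (bitAt w) 0<n refl last
                           (realization-orientation n (bitAt w) (λ _ → false)) (toℕ i) (toℕ≤pred[n] i))
                  (allFin (suc n)) ⟩
    map (λ i → bitAt w (toℕ i)) (allFin (suc n))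
      ≡⟨ subst (λ m → map (λ (i : Fin m) → bitAt w (toℕ i)) (allFin m) ≡ w) length-w
               (trans (map-tabulate id _) (tabulate-bitAt w)) ⟩
    w ∎

corollary3p12 : (n : ℕ) → 0 < n → (λs : List ℕ) → IsPartition λs →
    firstPart λs + length λs ≡ suc n →
    ∃[ c ] ((IsCoxeter n c × lam c ≡ λs) ×
      ((c′ : Vec (Fin (suc n)) (suc n)) → IsCoxeter n c′ → lam c′ ≡ λs → c′ ≡ c))
corollary3p12 n 0<n λs partition size =
  Vec.tabulate (coxProd σ) , ((σ , refl) , lam≡λs) ,
  λ { _ (σ′ , refl) lam′≡λs → coxeter-unique 0<n σ′ σ (trans lam′≡λs (sym lam≡λs)) }
  where
  σ : Permutation′ n
  σ = realization n (bitAt (pathOf λs))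
  lam≡λs : lam (Vec.tabulate (coxProd σ)) ≡ λs
  lam≡λs = coxeter-exists 0<n λs partition size
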